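{- For any terms $\mathfrak{t},\mathfrak{t}'$ over $\{\mathsf{M}\}$, we have $\mathfrak{t}\preccurlyeq\mathfrak{t}'$ if and only if at least one of the following holds: (i) $\mathfrak{t}=\mathsf{M}=\mathfrak{t}'$; (ii) $\mathfrak{t}=\mathsf{x}_i=\mathfrak{t}'$ for some variable $\mathsf{x}_i$; (iii) $\mathfrak{t}=\mathfrak{t}_1\mathfrak{t}_2$ and $\mathfrak{t}'=\mathfrak{t}'_1\mathfrak{t}'_2$ with $\mathfrak{t}_1\preccurlyeq\mathfrak{t}'_1$ and $\mathfrak{t}_2\preccurlyeq\mathfrak{t}'_2$; (iv) $\mathfrak{t}=\mathsf{M}\mathfrak{t}_2$ and $\mathfrak{t}'=\mathfrak{t}'_1\mathfrak{t}'_2$ with $\mathfrak{t}_2\preccurlyeq\mathfrak{t}'_1$ and $\mathfrak{t}_2\preccurlyeq\mathfrak{t}'_2$.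
   Context: Terms over $\{\mathsf{M}\}$: variables $\mathsf{x}_i$ ($i\ge1$), the constant $\mathsf{M}$, and applications $\mathfrak{t}_1\mathfrak{t}_2$ (binary trees with left subtree $\mathfrak{t}_1$, right subtree $\mathfrak{t}_2$). $\mathfrak{t}\Rightarrow\mathfrak{t}'$ iff $\mathfrak{t}'$ is obtained from $\mathfrak{t}$ by replacing one subterm of the form $\mathsf{M}\mathfrak{s}$ by $\mathfrak{s}\mathfrak{s}$; $\preccurlyeq$ is the reflexive and transitive closure of $\Rightarrow$. -}

module Defs where

open import Data.Nat using (ℕ)
open import Relation.Binary.Construct.Closure.ReflexiveTransitive using (Star)

-- Terms over {M}: variables x_i (i ≥ 1; `var i` stands for x_(i+1)), the constant M,
-- and applications (binary trees).
data Term : Set where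
  var : ℕ → Term
  M   : Term
  _·_ : Term → Term → Term

infixl 7 _·_

data _⇒_ : Term → Term → Set where
  here  : ∀ s → (M · s) ⇒ (s · s)
  left  : ∀ {t₁ t₁'} t₂ → t₁ ⇒ t₁' → (t₁ · t₂) ⇒ (t₁' · t₂)
  right : ∀ t₁ {t₂ t₂'} → t₂ ⇒ t₂' → (t₁ · t₂) ⇒ (t₁ · t₂')

infix 4 _⇒_ _≼_

_≼_ : Term → Term → Set
_≼_ = Star _⇒_

{-# OPTIONS --safe #-}
-- Read a reduction sequence backwards: the alternatives hold for the empty sequence and
-- survive prepending a step. A step inside a subterm extends the corresponding subterm
-- reduction (in the M · s case, the step inside s is a step of both copies of s), and a
-- root contraction M · s ⇒ s · s turns a pair of reductions from s · s into the last
-- alternative. Conversely, every alternative is realised by reducing the two subterms in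
-- turn, preceded by one root contraction in the last case.
module Submission where

open import Defs
open import Data.Nat using (ℕ)
open import Data.Product using (∃; _×_; _,_)
open import Data.Sum using (_⊎_; inj₁; inj₂)
open import Relation.Binary.PropositionalEquality using (_≡_; refl)
open import Function.Bundles using (_⇔_; mk⇔)
open import Relation.Binary.Construct.Closure.ReflexiveTransitive using (ε; _◅_; _◅◅_; gmap)

RootCases : Term → Term → Set
RootCases t t' =
  (t ≡ M × t' ≡ M)
  ⊎ (∃ λ (i : ℕ) → t ≡ var i × t' ≡ var i)
  ⊎ (∃ λ t₁ → ∃ λ t₂ → ∃ λ t₁' → ∃ λ t₂' →
       t ≡ t₁ · t₂ × t' ≡ t₁' · t₂' × t₁ ≼ t₁' × t₂ ≼ t₂')
  ⊎ (∃ λ t₂ → ∃ λ t₁' → ∃ λ t₂' →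
       t ≡ M · t₂ × t' ≡ t₁' · t₂' × t₂ ≼ t₁' × t₂ ≼ t₂')

pattern atConstant = inj₁ (refl , refl)
pattern atVariable i = inj₂ (inj₁ (i , refl , refl))
pattern inSubterms t₁ t₂ t₁' t₂' r₁ r₂ =
  inj₂ (inj₂ (inj₁ (t₁ , t₂ , t₁' , t₂' , refl , refl , r₁ , r₂)))
pattern contractedAtRoot t₂ t₁' t₂' r₁ r₂ =
  inj₂ (inj₂ (inj₂ (t₂ , t₁' , t₂' , refl , refl , r₁ , r₂)))

·-cong-≼ : ∀ {t₁ t₂ t₁' t₂'} → t₁ ≼ t₁' → t₂ ≼ t₂' → t₁ · t₂ ≼ t₁' · t₂'
·-cong-≼ {t₂ = t₂} {t₁' = t₁'} r₁ r₂ =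
  gmap (_· t₂) (left t₂) r₁ ◅◅ gmap (t₁' ·_) (right t₁') r₂

rootCases-refl : ∀ t → RootCases t t
rootCases-refl (var i)   = atVariable i
rootCases-refl M         = atConstant
rootCases-refl (t₁ · t₂) = inSubterms t₁ t₂ t₁ t₂ ε ε

rootCases-⇒-backward : ∀ {t u t'} → t ⇒ u → RootCases u t' → RootCases t t'
rootCases-⇒-backward (here s)     (inSubterms _ _ t₁' t₂' r₁ r₂) =
  contractedAtRoot s t₁' t₂' r₁ r₂
-- M · M ⇒ M · M: the step leaves the term unchanged.
rootCases-⇒-backward (here .M)    (contractedAtRoot .M t₁' t₂' r₁ r₂) =
  contractedAtRoot M t₁' t₂' r₁ r₂
rootCases-⇒-backward (left t₂ s)  (inSubterms _ _ t₁' t₂' r₁ r₂) =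
  inSubterms _ t₂ t₁' t₂' (s ◅ r₁) r₂
rootCases-⇒-backward (left t₂ ()) (contractedAtRoot _ _ _ _ _)
rootCases-⇒-backward (right t₁ s) (inSubterms _ _ t₁' t₂' r₁ r₂) =
  inSubterms t₁ _ t₁' t₂' r₁ (s ◅ r₂)
rootCases-⇒-backward (right .M s) (contractedAtRoot _ t₁' t₂' r₁ r₂) =
  contractedAtRoot _ t₁' t₂' (s ◅ r₁) (s ◅ r₂)
rootCases-⇒-backward (here _)    (inj₁ (() , _))
rootCases-⇒-backward (here _)    (inj₂ (inj₁ (_ , () , _)))
rootCases-⇒-backward (left _ _)  (inj₁ (() , _))
rootCases-⇒-backward (left _ _)  (inj₂ (inj₁ (_ , () , _)))
rootCases-⇒-backward (right _ _) (inj₁ (() , _))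
rootCases-⇒-backward (right _ _) (inj₂ (inj₁ (_ , () , _)))

≼⇒rootCases : ∀ {t t'} → t ≼ t' → RootCases t t'
≼⇒rootCases {t} ε = rootCases-refl t
≼⇒rootCases (s ◅ r) = rootCases-⇒-backward s (≼⇒rootCases r)

rootCases⇒≼ : ∀ {t t'} → RootCases t t' → t ≼ t'
rootCases⇒≼ atConstant                      = ε
rootCases⇒≼ (atVariable _)                  = ε
rootCases⇒≼ (inSubterms _ _ _ _ r₁ r₂)      = ·-cong-≼ r₁ r₂
rootCases⇒≼ (contractedAtRoot t₂ _ _ r₁ r₂) = here t₂ ◅ ·-cong-≼ r₁ r₂

lemma2p1p3 : ∀ (t t' : Term) →
    t ≼ t' ⇔
      ((t ≡ M × t' ≡ M)
      ⊎ (∃ λ (i : ℕ) → t ≡ var i × t' ≡ var i)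
      ⊎ (∃ λ t₁ → ∃ λ t₂ → ∃ λ t₁' → ∃ λ t₂' →
           t ≡ t₁ · t₂ × t' ≡ t₁' · t₂' × t₁ ≼ t₁' × t₂ ≼ t₂')
      ⊎ (∃ λ t₂ → ∃ λ t₁' → ∃ λ t₂' →
           t ≡ M · t₂ × t' ≡ t₁' · t₂' × t₂ ≼ t₁' × t₂ ≼ t₂'))
lemma2p1p3 t t' = mk⇔ ≼⇒rootCases rootCases⇒≼
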